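{- Let $\beta>0$ and $t\ge 1$. Let $G$ be a bipartite graph with bipartition $(U,W)$ such that $|W|\ge t|U|$, and let $n=|U|+|W|$. If $G$ is a weakly $(n,\beta)$-graph, then $$\alpha'(G)\ge \min\left\{t(1-2\beta^2),\,1\right\}\cdot |U|.$$
   Context: All graphs are finite, simple and nonempty. $\alpha'(G)$ denotes the matching number. For $\beta>0$, a graph $G$ on $n$ vertices is a weakly $(n,\beta)$-graph if $\frac{|X||Y|}{(n-|X|)(n-|Y|)}\le\beta^2$ for every pair of disjoint proper subsets $X,Y$ of $V(G)$ with no edge between $X$ and $Y$.
   Formalization: The parameters β and t range over the rationals. -}

module Defs where

open import Data.Bool using (Bool; true; false)
open import Data.Nat as ℕ using (ℕ; suc; _∸_)
open import Data.Fin using (Fin)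
open import Data.Fin.Subset using (Subset; _∈_; _∉_; ∣_∣; ⊤)
open import Data.Product using (_×_; _,_; Σ; ∃)
open import Data.List using (List; length; concatMap; _∷_; [])
open import Data.List.Relation.Unary.All using (All)
open import Data.List.Relation.Unary.Unique.Propositional using (Unique)
open import Data.Empty using (⊥)
open import Relation.Nullary using (¬_)
open import Relation.Binary.PropositionalEquality using (_≡_)
open import Data.Rational as ℚ using (ℚ; _≤_; _*_)
open import Data.Integer using (+_)

record Graph (n : ℕ) : Set where
  field
    adj     : Fin n → Fin n → Bool
    sym     : ∀ u v → adj u v ≡ adj v u
    irrefl  : ∀ v → adj v v ≡ false

open Graph public

ℕ→ℚ : ℕ → ℚ
ℕ→ℚ k = + k ℚ./ 1

NoEdgeBetween : ∀ {n} → Graph n → Subset n → Subset n → Set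
NoEdgeBetween G X Y = ∀ x y → x ∈ X → y ∈ Y → adj G x y ≡ false

Disjoint : ∀ {n} → Subset n → Subset n → Set
Disjoint X Y = ∀ v → v ∈ X → v ∈ Y → ⊥

Proper : ∀ {n} → Subset n → Set
Proper X = ¬ (X ≡ ⊤)

-- Weakly (n,β)-graph: for all disjoint proper X, Y with no edge between them,
-- |X||Y| / ((n-|X|)(n-|Y|)) ≤ β².  Since X, Y are proper, the denominator is
-- a positive integer, so this is stated in cross-multiplied form.
WeaklyGraph : ∀ {n} → Graph n → ℚ → Set
WeaklyGraph {n} G β =
  ∀ (X Y : Subset n) → Proper X → Proper Y → Disjoint X Y → NoEdgeBetween G X Y →
    ℕ→ℚ (∣ X ∣ ℕ.* ∣ Y ∣) ≤ (β * β) * ℕ→ℚ ((n ∸ ∣ X ∣) ℕ.* (n ∸ ∣ Y ∣))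

IsBipartition : ∀ {n} → Graph n → Subset n → Subset n → Set
IsBipartition {n} G U W =
  (∀ v → (v ∈ U × v ∉ W) Data.Sum.⊎ (v ∉ U × v ∈ W)) ×
  (∀ u v → adj G u v ≡ true → (u ∈ U × v ∈ W) Data.Sum.⊎ (u ∈ W × v ∈ U))
  where import Data.Sum

-- A matching: a list of edges, whose endpoints are pairwise distinct
-- (so the edges are pairwise vertex-disjoint and listed without repetition).
endpoints : ∀ {n} → List (Fin n × Fin n) → List (Fin n)
endpoints = concatMap (λ { (u , v) → u ∷ v ∷ [] })

IsMatching : ∀ {n} → Graph n → List (Fin n × Fin n) → Set
IsMatching G M = All (λ { (u , v) → adj G u v ≡ true }) M × Unique (endpoints M)

MatchingNumber≥ : ∀ {n} → Graph n → ℚ → Set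
MatchingNumber≥ {n} G c = Σ (List (Fin n × Fin n)) λ M → IsMatching G M × c ≤ ℕ→ℚ (length M)

-- By the deficiency form of Hall's theorem there are a matching M and a set S ⊆ U with
-- ∣U∣ − ∣M∣ ≤ ∣S∣ − ∣N(S)∣ =: D; it is proved by the Halmos–Vaughan induction, splitting along a
-- tight set when there is one and otherwise matching, or discarding, a single vertex. If ∣M∣ < ∣U∣
-- then S ≠ ∅, and since G is bipartite no edge joins S to Y = V ∖ (S ∪ N(S)), so the weak (n,β)
-- condition gives ∣S∣(n − ∣S∣ − ∣N(S)∣) ≤ β²(n − ∣S∣)(∣S∣ + ∣N(S)∣). As ∣N(S)∣ ≤ ∣S∣ ≤ ∣U∣ this
-- forces ∣W∣ − ∣U∣ + D ≤ 2β²∣W∣, that is ∣M∣ ≥ ∣U∣ − D ≥ (1 − 2β²)∣W∣ ≥ t(1 − 2β²)∣U∣.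

module Submission where

open import Defs hiding (sym)

module Arithmetic where

  open import Data.Nat as ℕ using (ℕ; suc; _∸_)
  import Data.Nat.Properties as ℕ
  open import Data.Nat.Tactic.RingSolver using (solve-∀)
  open import Data.Integer as ℤ using (+_)
  import Data.Integer.Properties as ℤ
  import Data.Nat.Coprimality as Coprime
  open import Data.Rational using (ℚ; mkℚ; 0ℚ; 1ℚ; _≤_; _+_; _*_; _-_; -_; _⊓_; *≤*; NonNegative; Positive; nonNegative)
  open import Data.Rational.Properties
  import Data.Rational.Unnormalised as ℚᵘ
  import Data.Rational.Unnormalised.Properties as ℚᵘ
  open import Data.Rational.Solver using (module +-*-Solver)
  open import Data.Product using (_,_)
  open import Data.Sum using (inj₁; inj₂)
  open import Relation.Binary.PropositionalEquality

  -- ℕ→ℚ normalises through a gcd, so it is first rewritten to the literal fraction k/1.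
  private
    integral : ℕ → ℚ
    integral k = mkℚ (+ k) 0 (Coprime.sym (Coprime.1-coprimeTo k))

    ℕ→ℚ≡integral : ∀ k → ℕ→ℚ k ≡ integral k
    ℕ→ℚ≡integral k = normalize-coprime (Coprime.sym (Coprime.1-coprimeTo k))

  ℕ→ℚ-+ : ∀ a b → ℕ→ℚ (a ℕ.+ b) ≡ ℕ→ℚ a + ℕ→ℚ b
  ℕ→ℚ-+ a b rewrite ℕ→ℚ≡integral a | ℕ→ℚ≡integral b | ℕ→ℚ≡integral (a ℕ.+ b) =
    toℚᵘ-injective (ℚᵘ.≃-sym (ℚᵘ.≃-trans (toℚᵘ-homo-+ (integral a) (integral b))
      (ℚᵘ.*≡* (cong (ℤ._* + 1) (trans (cong₂ ℤ._+_ (ℤ.*-identityʳ (+ a)) (ℤ.*-identityʳ (+ b))) (sym (ℤ.pos-+ a b)))))))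

  ℕ→ℚ-* : ∀ a b → ℕ→ℚ (a ℕ.* b) ≡ ℕ→ℚ a * ℕ→ℚ b
  ℕ→ℚ-* a b rewrite ℕ→ℚ≡integral a | ℕ→ℚ≡integral b | ℕ→ℚ≡integral (a ℕ.* b) =
    toℚᵘ-injective (ℚᵘ.≃-sym (ℚᵘ.≃-trans (toℚᵘ-homo-* (integral a) (integral b))
      (ℚᵘ.*≡* (cong (ℤ._* + 1) (sym (ℤ.pos-* a b))))))

  ℕ→ℚ-mono-≤ : ∀ {a b} → a ℕ.≤ b → ℕ→ℚ a ≤ ℕ→ℚ b
  ℕ→ℚ-mono-≤ {a} {b} a≤b rewrite ℕ→ℚ≡integral a | ℕ→ℚ≡integral b =
    *≤* (subst₂ ℤ._≤_ (sym (ℤ.*-identityʳ (+ a))) (sym (ℤ.*-identityʳ (+ b))) (ℤ.+≤+ a≤b))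

  ℕ→ℚ-cancel-≤ : ∀ {a b} → ℕ→ℚ a ≤ ℕ→ℚ b → a ℕ.≤ b
  ℕ→ℚ-cancel-≤ {a} {b} rewrite ℕ→ℚ≡integral a | ℕ→ℚ≡integral b = λ where
    (*≤* le) → ℤ.drop‿+≤+ (subst₂ ℤ._≤_ (ℤ.*-identityʳ (+ a)) (ℤ.*-identityʳ (+ b)) le)

  ℕ→ℚ-nonNeg : ∀ k → NonNegative (ℕ→ℚ k)
  ℕ→ℚ-nonNeg k rewrite ℕ→ℚ≡integral k = _

  ℕ→ℚ-pos : ∀ k → Positive (ℕ→ℚ (suc k))
  ℕ→ℚ-pos k rewrite ℕ→ℚ≡integral (suc k) = _

  module _ where
    open +-*-Solver

    [1-2B]w+2wB≡w : ∀ B w → (1ℚ - ℕ→ℚ 2 * B) * w + ℕ→ℚ 2 * w * B ≡ w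
    [1-2B]w+2wB≡w = solve 2 (λ B w → (con 1ℚ :- con (ℕ→ℚ 2) :* B) :* w :+ con (ℕ→ℚ 2) :* w :* B := w) refl

    p≡[p+q]-q : ∀ p q → p ≡ (p + q) - q
    p≡[p+q]-q = solve 2 (λ p q → p := (p :+ q) :- q) refl

  +-cancelʳ-≤ : ∀ r {p q} → p + r ≤ q + r → p ≤ q
  +-cancelʳ-≤ r {p} {q} le = subst₂ _≤_ (sym (p≡[p+q]-q p r)) (sym (p≡[p+q]-q q r)) (+-monoˡ-≤ (- r) le)

  deficit-bound : ∀ B {w ν E} → w ℕ.≤ ν ℕ.+ E → ℕ→ℚ E ≤ ℕ→ℚ (2 ℕ.* w) * B →
                  (1ℚ - ℕ→ℚ 2 * B) * ℕ→ℚ w ≤ ℕ→ℚ ν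
  deficit-bound B {w} {ν} {E} w≤ν+E E≤2wB = +-cancelʳ-≤ (ℕ→ℚ E) (begin
    (1ℚ - ℕ→ℚ 2 * B) * ℕ→ℚ w + ℕ→ℚ E                 ≤⟨ +-monoʳ-≤ ((1ℚ - ℕ→ℚ 2 * B) * ℕ→ℚ w) E≤2wB ⟩
    (1ℚ - ℕ→ℚ 2 * B) * ℕ→ℚ w + ℕ→ℚ (2 ℕ.* w) * B   ≡⟨ cong (λ x → (1ℚ - ℕ→ℚ 2 * B) * ℕ→ℚ w + x * B) (ℕ→ℚ-* 2 w) ⟩
    (1ℚ - ℕ→ℚ 2 * B) * ℕ→ℚ w + ℕ→ℚ 2 * ℕ→ℚ w * B     ≡⟨ [1-2B]w+2wB≡w B (ℕ→ℚ w) ⟩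
    ℕ→ℚ w                                             ≤⟨ ℕ→ℚ-mono-≤ w≤ν+E ⟩
    ℕ→ℚ (ν ℕ.+ E)                                     ≡⟨ ℕ→ℚ-+ ν E ⟩
    ℕ→ℚ ν + ℕ→ℚ E                                     ∎)
    where open ≤-Reasoning

  ⊓-scaled-bound : ∀ {t A} {u w ν} → 0ℚ ≤ t → t * ℕ→ℚ u ≤ ℕ→ℚ w → A * ℕ→ℚ w ≤ ℕ→ℚ ν →
                   (t * A ⊓ 1ℚ) * ℕ→ℚ u ≤ ℕ→ℚ ν
  ⊓-scaled-bound {t} {A} {u} {w} {ν} 0≤t tu≤w Aw≤ν = ≤-trans min≤tAu tAu≤ν
    where
    instance _ = ℕ→ℚ-nonNeg u
    min≤tAu : (t * A ⊓ 1ℚ) * ℕ→ℚ u ≤ t * A * ℕ→ℚ u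
    min≤tAu = *-monoʳ-≤-nonNeg (ℕ→ℚ u) (p⊓q≤p (t * A) 1ℚ)
    tAu≤ν : t * A * ℕ→ℚ u ≤ ℕ→ℚ ν
    tAu≤ν with ≤-total A 0ℚ
    ... | inj₁ A≤0 = begin
      t * A * ℕ→ℚ u  ≤⟨ *-monoʳ-≤-nonNeg (ℕ→ℚ u) (*-monoˡ-≤-nonNeg t {{nonNegative 0≤t}} A≤0) ⟩
      t * 0ℚ * ℕ→ℚ u ≡⟨ cong (_* ℕ→ℚ u) (*-zeroʳ t) ⟩
      0ℚ * ℕ→ℚ u     ≡⟨ *-zeroˡ (ℕ→ℚ u) ⟩
      0ℚ             ≤⟨ ℕ→ℚ-mono-≤ {0} {ν} ℕ.z≤n ⟩
      ℕ→ℚ ν          ∎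
      where open ≤-Reasoning
    ... | inj₂ 0≤A = begin
      t * A * ℕ→ℚ u   ≡⟨ cong (_* ℕ→ℚ u) (*-comm t A) ⟩
      A * t * ℕ→ℚ u   ≡⟨ *-assoc A t (ℕ→ℚ u) ⟩
      A * (t * ℕ→ℚ u) ≤⟨ *-monoˡ-≤-nonNeg A {{nonNegative 0≤A}} tu≤w ⟩
      A * ℕ→ℚ w       ≤⟨ Aw≤ν ⟩
      ℕ→ℚ ν           ∎
      where open ≤-Reasoning

  cross-multiplied-≤ : ∀ B {E F P Q} .{{_ : ℕ.NonZero P}} → ℕ→ℚ Q ≤ B * ℕ→ℚ P → E ℕ.* P ℕ.≤ F ℕ.* Q → ℕ→ℚ E ≤ ℕ→ℚ F * B
  cross-multiplied-≤ B {E} {F} {suc P} {Q} Q≤BP EP≤FQ = *-cancelʳ-≤-pos (ℕ→ℚ (suc P)) {{ℕ→ℚ-pos P}} (begin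
    ℕ→ℚ E * ℕ→ℚ (suc P)   ≡⟨ ℕ→ℚ-* E (suc P) ⟨
    ℕ→ℚ (E ℕ.* suc P)     ≤⟨ ℕ→ℚ-mono-≤ EP≤FQ ⟩
    ℕ→ℚ (F ℕ.* Q)         ≡⟨ ℕ→ℚ-* F Q ⟩
    ℕ→ℚ F * ℕ→ℚ Q         ≤⟨ *-monoˡ-≤-nonNeg (ℕ→ℚ F) {{ℕ→ℚ-nonNeg F}} Q≤BP ⟩
    ℕ→ℚ F * (B * ℕ→ℚ (suc P)) ≡⟨ *-assoc (ℕ→ℚ F) B _ ⟨
    ℕ→ℚ F * B * ℕ→ℚ (suc P) ∎)
    where open ≤-Reasoning

  scaled-≤⇒≤ : ∀ {t a b} → 1ℚ ≤ t → t * ℕ→ℚ a ≤ ℕ→ℚ b → a ℕ.≤ b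
  scaled-≤⇒≤ {t} {a} 1≤t ta≤b = ℕ→ℚ-cancel-≤ (begin
    ℕ→ℚ a        ≡⟨ *-identityˡ (ℕ→ℚ a) ⟨
    1ℚ * ℕ→ℚ a   ≤⟨ *-monoʳ-≤-nonNeg (ℕ→ℚ a) {{ℕ→ℚ-nonNeg a}} 1≤t ⟩
    t * ℕ→ℚ a    ≤⟨ ta≤b ⟩
    _            ∎)
    where open ≤-Reasoning

  ν<u≤ν+d⇒0<d : ∀ {u ν d} → ν ℕ.< u → u ℕ.≤ ν ℕ.+ d → 0 ℕ.< d
  ν<u≤ν+d⇒0<d {u} {ν} {d} ν<u u≤ν+d =
    ℕ.+-cancelˡ-< ν 0 d (ℕ.<-≤-trans (subst (ℕ._< u) (sym (ℕ.+-identityʳ ν)) ν<u) u≤ν+d)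

  -- Writing s = ∣S∣ = k + D with k = ∣N(S)∣ and D the deficiency of S, u = s + a and w = u + c,
  -- this is (w − u + D)(n − s)(s + k) ≤ 2w · s(n − s − k).
  deficit-core : ∀ k D a c → let s = k ℕ.+ D ; w = s ℕ.+ a ℕ.+ c in
    (c ℕ.+ D) ℕ.* ((a ℕ.+ w) ℕ.* (s ℕ.+ k)) ℕ.≤ 2 ℕ.* w ℕ.* (s ℕ.* (a ℕ.+ D ℕ.+ a ℕ.+ c))
  deficit-core k D a c = begin
    (c ℕ.+ D) ℕ.* ((a ℕ.+ w) ℕ.* (s ℕ.+ k))
      ≤⟨ ℕ.*-monoʳ-≤ (c ℕ.+ D) (ℕ.*-monoʳ-≤ (a ℕ.+ w) (ℕ.+-monoʳ-≤ s (ℕ.m≤m+n k D))) ⟩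
    (c ℕ.+ D) ℕ.* ((a ℕ.+ w) ℕ.* (s ℕ.+ s))
      ≤⟨ ℕ.m≤m+n _ _ ⟩
    (c ℕ.+ D) ℕ.* ((a ℕ.+ w) ℕ.* (s ℕ.+ s)) ℕ.+ (s ℕ.+ s) ℕ.* (a ℕ.* (w ℕ.+ k ℕ.+ a))
      ≡⟨ deficit-identity k D a c ⟩
    2 ℕ.* w ℕ.* (s ℕ.* (a ℕ.+ D ℕ.+ a ℕ.+ c)) ∎
    where
    open ℕ.≤-Reasoning
    s = k ℕ.+ D
    w = s ℕ.+ a ℕ.+ c
    deficit-identity : ∀ k D a c → let s = k ℕ.+ D ; w = s ℕ.+ a ℕ.+ c in
      (c ℕ.+ D) ℕ.* ((a ℕ.+ w) ℕ.* (s ℕ.+ s)) ℕ.+ (s ℕ.+ s) ℕ.* (a ℕ.* (w ℕ.+ k ℕ.+ a))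
        ≡ 2 ℕ.* w ℕ.* (s ℕ.* (a ℕ.+ D ℕ.+ a ℕ.+ c))
    deficit-identity = solve-∀

  deficient-set-bound′ : ∀ B t → 0ℚ ≤ t → ∀ ν k D a c y →
    let s = k ℕ.+ D ; u = s ℕ.+ a ; w = u ℕ.+ c in
    s ℕ.+ k ℕ.+ y ≡ u ℕ.+ w → t * ℕ→ℚ u ≤ ℕ→ℚ w → ν ℕ.< u → u ℕ.≤ ν ℕ.+ D →
    ℕ→ℚ (s ℕ.* y) ≤ B * ℕ→ℚ ((u ℕ.+ w ∸ s) ℕ.* (u ℕ.+ w ∸ y)) →
    (t * (1ℚ - ℕ→ℚ 2 * B) ⊓ 1ℚ) * ℕ→ℚ u ≤ ℕ→ℚ ν
  deficient-set-bound′ B t 0≤t ν k D a c y s+k+y≡n tu≤w ν<u u≤ν+D weak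
    = ⊓-scaled-bound {u = u} {w} {ν} 0≤t tu≤w (deficit-bound B {w} {ν} {c ℕ.+ D} w≤ν+E
        (cross-multiplied-≤ B {c ℕ.+ D} {2 ℕ.* w} {{P≢0}} weak′ (deficit-core k D a c)))
    where
    s = k ℕ.+ D
    u = s ℕ.+ a
    w = u ℕ.+ c
    y≡a+D+a+c : y ≡ a ℕ.+ D ℕ.+ a ℕ.+ c
    y≡a+D+a+c = ℕ.+-cancelˡ-≡ (s ℕ.+ k) y _ (trans s+k+y≡n (rearrange k D a c))
      where
      rearrange : ∀ k D a c → (k ℕ.+ D ℕ.+ a) ℕ.+ (k ℕ.+ D ℕ.+ a ℕ.+ c) ≡ k ℕ.+ D ℕ.+ k ℕ.+ (a ℕ.+ D ℕ.+ a ℕ.+ c)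
      rearrange = solve-∀
    n∸s≡a+w : u ℕ.+ w ∸ s ≡ a ℕ.+ w
    n∸s≡a+w = trans (cong (_∸ s) (ℕ.+-assoc s a w)) (ℕ.m+n∸m≡n s (a ℕ.+ w))
    n∸y≡s+k : u ℕ.+ w ∸ y ≡ s ℕ.+ k
    n∸y≡s+k = trans (cong (_∸ y) (sym s+k+y≡n)) (ℕ.m+n∸n≡m (s ℕ.+ k) y)
    weak′ : ℕ→ℚ (s ℕ.* (a ℕ.+ D ℕ.+ a ℕ.+ c)) ≤ B * ℕ→ℚ ((a ℕ.+ w) ℕ.* (s ℕ.+ k))
    weak′ = subst₂ (λ z P → ℕ→ℚ (s ℕ.* z) ≤ B * ℕ→ℚ P) y≡a+D+a+c (cong₂ ℕ._*_ n∸s≡a+w n∸y≡s+k) weak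
    0<D : 0 ℕ.< D
    0<D = ν<u≤ν+d⇒0<d ν<u u≤ν+D
    D≤s : D ℕ.≤ s
    D≤s = ℕ.m≤n+m D k
    P≢0 : ℕ.NonZero ((a ℕ.+ w) ℕ.* (s ℕ.+ k))
    P≢0 = ℕ.m*n≢0 (a ℕ.+ w) (s ℕ.+ k)
      {{ℕ.>-nonZero (ℕ.<-≤-trans 0<D (ℕ.≤-trans D≤s (ℕ.≤-trans (ℕ.m≤m+n s a) (ℕ.≤-trans (ℕ.m≤m+n u c) (ℕ.m≤n+m w a)))))}}
      {{ℕ.>-nonZero (ℕ.<-≤-trans 0<D (ℕ.≤-trans D≤s (ℕ.m≤m+n s k)))}}
    w≤ν+E : w ℕ.≤ ν ℕ.+ (c ℕ.+ D)
    w≤ν+E = ℕ.≤-trans (ℕ.+-monoˡ-≤ c u≤ν+D) (ℕ.≤-reflexive (trans (ℕ.+-assoc ν D c) (cong (ν ℕ.+_) (ℕ.+-comm D c))))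

  deficient-set-bound : ∀ B t → 1ℚ ≤ t → ∀ {n u w ν s k y} →
    u ℕ.+ w ≡ n → s ℕ.+ k ℕ.+ y ≡ n → t * ℕ→ℚ u ≤ ℕ→ℚ w →
    s ℕ.≤ u → ν ℕ.< u → u ℕ.+ k ℕ.≤ ν ℕ.+ s →
    ℕ→ℚ (s ℕ.* y) ≤ B * ℕ→ℚ ((n ∸ s) ℕ.* (n ∸ y)) →
    (t * (1ℚ - ℕ→ℚ 2 * B) ⊓ 1ℚ) * ℕ→ℚ u ≤ ℕ→ℚ ν
  deficient-set-bound B t 1≤t {u = u} {w} {ν} {s} {k} {y} refl s+k+y≡n tu≤w s≤u ν<u u+k≤ν+s weak
    with ℕ.m≤n⇒∃[o]m+o≡n k≤s | ℕ.m≤n⇒∃[o]m+o≡n s≤u | ℕ.m≤n⇒∃[o]m+o≡n u≤w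
    where
    k≤s : k ℕ.≤ s
    k≤s = ℕ.<⇒≤ (ℕ.+-cancelˡ-< ν k s (ℕ.<-≤-trans (ℕ.+-monoˡ-< k ν<u) u+k≤ν+s))
    u≤w : u ℕ.≤ w
    u≤w = scaled-≤⇒≤ 1≤t tu≤w
  ... | D , refl | a , refl | c , refl =
    deficient-set-bound′ B t (≤-trans (ℕ→ℚ-mono-≤ {0} {1} ℕ.z≤n) 1≤t) ν k D a c y s+k+y≡n tu≤w ν<u u≤ν+D weak
    where
    u≤ν+D : k ℕ.+ D ℕ.+ a ℕ.≤ ν ℕ.+ D
    u≤ν+D = ℕ.+-cancelʳ-≤ k _ _ (ℕ.≤-trans u+k≤ν+s (ℕ.≤-reflexive (trans (cong (ν ℕ.+_) (ℕ.+-comm k D)) (sym (ℕ.+-assoc ν D k)))))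

  deficient-set-proper : ∀ {t n u w ν s} → 1ℚ ≤ t → t * ℕ→ℚ u ≤ ℕ→ℚ w → u ℕ.+ w ≡ n →
    ν ℕ.< u → s ℕ.≤ u → s ℕ.< n
  deficient-set-proper {u = u} 1≤t tu≤w refl ν<u s≤u =
    ℕ.≤-<-trans s≤u (ℕ.m<m+n u (ℕ.<-≤-trans (ℕ.≤-<-trans ℕ.z≤n ν<u) (scaled-≤⇒≤ 1≤t tu≤w)))

  ⊓1-bound : ∀ c {u ν} → u ℕ.≤ ν → (c ⊓ 1ℚ) * ℕ→ℚ u ≤ ℕ→ℚ ν
  ⊓1-bound c {u} {ν} u≤ν = begin
    (c ⊓ 1ℚ) * ℕ→ℚ u  ≤⟨ *-monoʳ-≤-nonNeg (ℕ→ℚ u) {{ℕ→ℚ-nonNeg u}} (p⊓q≤q c 1ℚ) ⟩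
    1ℚ * ℕ→ℚ u        ≡⟨ *-identityˡ (ℕ→ℚ u) ⟩
    ℕ→ℚ u             ≤⟨ ℕ→ℚ-mono-≤ u≤ν ⟩
    ℕ→ℚ ν             ∎
    where open ≤-Reasoning

module Matching where

  open import Data.Bool as Bool using (true)
  open import Data.Bool.Properties using (T-≡)
  open import Data.Empty using (⊥-elim)
  import Data.Fin as Fin
  open import Data.Fin using (Fin)
  open import Data.Fin.Properties using (any?)
  open import Data.Fin.Subset using (Subset; _∈_; _∉_; _⊆_; _∪_; _─_; _-_; ⁅_⁆; ∁; ∣_∣; Empty; inside; outside; ⊤)
    renaming (⊥ to ∅)
  open import Data.Fin.Subset.Properties
  open import Data.List using (List; []; _∷_; _++_; length)
  open import Data.List.Properties using (length-++; concatMap-++)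
  open import Data.List.Relation.Unary.All as All using (All; []; _∷_)
  import Data.List.Relation.Unary.All.Properties as All
  open import Data.List.Relation.Unary.Unique.Propositional using (Unique)
  import Data.List.Relation.Unary.Unique.Propositional.Properties as Unique
  open import Data.List.Relation.Unary.AllPairs using ([]; _∷_)
  open import Data.List.Membership.Propositional using () renaming (_∈_ to _∈ₗ_)
  open import Data.Nat as ℕ using (ℕ; zero; suc; _+_; _≤_; _<_; _∸_; z≤n; s≤s; _≤?_; _<?_)
  import Data.Nat.Properties as ℕ
  open import Data.Product using (_×_; _,_; ∃; ∃₂; proj₁; proj₂)
  open import Data.Sum using (_⊎_; inj₁; inj₂)
  open import Data.Vec using ([]; _∷_; here; there; tabulate)
  open import Data.Vec.Properties using (lookup∘tabulate; lookup⇒[]=; []=⇒lookup)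
  open import Function using (Equivalence; _∘_; id)
  open import Relation.Nullary using (¬_; Dec; yes; no)
  open import Data.Nat.Tactic.RingSolver using (solve-∀)
  open import Relation.Nullary.Decidable using (_×-dec_; isYes; toWitness; fromWitness)
  open import Relation.Binary.PropositionalEquality

  private variable
    n : ℕ
    x : Fin n
    p q : Subset n

  x∈p─q⇒x∉q : x ∈ p ─ q → x ∉ q
  x∈p─q⇒x∉q {p = _ ∷ p} {q = outside ∷ q} (there x∈p─q) (there x∈q) = x∈p─q⇒x∉q x∈p─q x∈q
  x∈p─q⇒x∉q {p = _ ∷ p} {q = inside  ∷ q} (there x∈p─q) (there x∈q) = x∈p─q⇒x∉q x∈p─q x∈q

  ∣p∪q∣≤∣p∣+∣q∣ : ∀ (p q : Subset n) → ∣ p ∪ q ∣ ≤ ∣ p ∣ + ∣ q ∣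
  ∣p∪q∣≤∣p∣+∣q∣ []            []            = z≤n
  ∣p∪q∣≤∣p∣+∣q∣ (outside ∷ p) (outside ∷ q) = ∣p∪q∣≤∣p∣+∣q∣ p q
  ∣p∪q∣≤∣p∣+∣q∣ (outside ∷ p) (inside  ∷ q) = ℕ.≤-trans (s≤s (∣p∪q∣≤∣p∣+∣q∣ p q)) (ℕ.≤-reflexive (sym (ℕ.+-suc ∣ p ∣ ∣ q ∣)))
  ∣p∪q∣≤∣p∣+∣q∣ (inside  ∷ p) (outside ∷ q) = s≤s (∣p∪q∣≤∣p∣+∣q∣ p q)
  ∣p∪q∣≤∣p∣+∣q∣ (inside  ∷ p) (inside  ∷ q) = s≤s (ℕ.≤-trans (∣p∪q∣≤∣p∣+∣q∣ p q) (ℕ.+-monoʳ-≤ ∣ p ∣ (ℕ.n≤1+n ∣ q ∣)))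

  ∣p∪q∣≡∣p∣+∣q∣ : ∀ (p q : Subset n) → Disjoint p q → ∣ p ∪ q ∣ ≡ ∣ p ∣ + ∣ q ∣
  ∣p∪q∣≡∣p∣+∣q∣ []            []            _ = refl
  ∣p∪q∣≡∣p∣+∣q∣ (outside ∷ p) (outside ∷ q) d = ∣p∪q∣≡∣p∣+∣q∣ p q (λ v a b → d (Fin.suc v) (there a) (there b))
  ∣p∪q∣≡∣p∣+∣q∣ (outside ∷ p) (inside  ∷ q) d =
    trans (cong suc (∣p∪q∣≡∣p∣+∣q∣ p q (λ v a b → d (Fin.suc v) (there a) (there b)))) (sym (ℕ.+-suc ∣ p ∣ ∣ q ∣))
  ∣p∪q∣≡∣p∣+∣q∣ (inside  ∷ p) (outside ∷ q) d = cong suc (∣p∪q∣≡∣p∣+∣q∣ p q (λ v a b → d (Fin.suc v) (there a) (there b)))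
  ∣p∪q∣≡∣p∣+∣q∣ (inside  ∷ p) (inside  ∷ q) d = ⊥-elim (d Fin.zero here here)

  ∣p∣≡∣p─q∣+∣q∣ : ∀ (p q : Subset n) → q ⊆ p → ∣ p ∣ ≡ ∣ p ─ q ∣ + ∣ q ∣
  ∣p∣≡∣p─q∣+∣q∣ []            []            _   = refl
  ∣p∣≡∣p─q∣+∣q∣ (outside ∷ p) (outside ∷ q) q⊆p = ∣p∣≡∣p─q∣+∣q∣ p q (drop-∷-⊆ q⊆p)
  ∣p∣≡∣p─q∣+∣q∣ (inside  ∷ p) (outside ∷ q) q⊆p = cong suc (∣p∣≡∣p─q∣+∣q∣ p q (drop-∷-⊆ q⊆p))
  ∣p∣≡∣p─q∣+∣q∣ (outside ∷ p) (inside  ∷ q) q⊆p with () ← q⊆p here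
  ∣p∣≡∣p─q∣+∣q∣ (inside  ∷ p) (inside  ∷ q) q⊆p =
    trans (cong suc (∣p∣≡∣p─q∣+∣q∣ p q (drop-∷-⊆ q⊆p))) (sym (ℕ.+-suc ∣ p ─ q ∣ ∣ q ∣))

  ∣p∣+∣∁p∣≡n : ∀ (p : Subset n) → ∣ p ∣ + ∣ ∁ p ∣ ≡ n
  ∣p∣+∣∁p∣≡n p = trans (cong (∣ p ∣ +_) (∣∁p∣≡n∸∣p∣ p)) (ℕ.m+[n∸m]≡n (∣p∣≤n p))

  ∣p∣<n⇒p≢⊤ : ∀ {n} {p : Subset n} → ∣ p ∣ < n → p ≢ ⊤
  ∣p∣<n⇒p≢⊤ {n} ∣p∣<n p≡⊤ = ℕ.<-irrefl (∣⊤∣≡n n) (subst (λ q → ∣ q ∣ < n) p≡⊤ ∣p∣<n)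

  disjoint-⊆ : ∀ {p q p′ q′ : Subset n} → Disjoint p q → p′ ⊆ p → q′ ⊆ q → Disjoint p′ q′
  disjoint-⊆ p∩q≡∅ p′⊆p q′⊆q v v∈p′ v∈q′ = p∩q≡∅ v (p′⊆p v∈p′) (q′⊆q v∈q′)

  ∪-lub : ∀ {p q r : Subset n} → p ⊆ r → q ⊆ r → p ∪ q ⊆ r
  ∪-lub {p = p} {q} p⊆r q⊆r x∈p∪q with x∈p∪q⁻ p q x∈p∪q
  ... | inj₁ x∈p = p⊆r x∈p
  ... | inj₂ x∈q = q⊆r x∈q

  x∈p⇒⁅x⁆⊆p : x ∈ p → ⁅ x ⁆ ⊆ p
  x∈p⇒⁅x⁆⊆p {x = x} {p} x∈p y∈⁅x⁆ = subst (_∈ p) (sym (x∈⁅y⁆⇒x≡y x y∈⁅x⁆)) x∈p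

  x∈p⇒∣p∣≡∣p-x∣+1 : x ∈ p → ∣ p ∣ ≡ ∣ p - x ∣ + 1
  x∈p⇒∣p∣≡∣p-x∣+1 {x = x} {p} x∈p = trans (∣p∣≡∣p─q∣+∣q∣ p ⁅ x ⁆ (x∈p⇒⁅x⁆⊆p x∈p)) (cong (∣ p - x ∣ +_) (∣⁅x⁆∣≡1 x))

  module _ {n} (G : Graph n) where

    Adjacent : Subset n → Subset n → Fin n → Set
    Adjacent R S y = y ∈ R × ∃ λ x → x ∈ S × adj G x y ≡ true

    adjacent? : ∀ R S y → Dec (Adjacent R S y)
    adjacent? R S y = y ∈? R ×-dec any? (λ x → x ∈? S ×-dec (adj G x y Bool.≟ true))

    neighbours : Subset n → Subset n → Subset n
    neighbours R S = tabulate (isYes ∘ adjacent? R S)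

    ∈-neighbours⁺ : ∀ {R S x y} → y ∈ R → x ∈ S → adj G x y ≡ true → y ∈ neighbours R S
    ∈-neighbours⁺ {R} {S} {x} {y} y∈R x∈S xy = lookup⇒[]= y (neighbours R S)
      (trans (lookup∘tabulate _ y) (Equivalence.to T-≡ (fromWitness {a? = adjacent? R S y} (y∈R , x , x∈S , xy))))

    ∈-neighbours⁻ : ∀ {R S y} → y ∈ neighbours R S → Adjacent R S y
    ∈-neighbours⁻ {R} {S} {y} y∈N = toWitness {a? = adjacent? R S y}
      (Equivalence.from T-≡ (trans (sym (lookup∘tabulate _ y)) ([]=⇒lookup y∈N)))

    neighbours⊆ : ∀ {R S} → neighbours R S ⊆ R
    neighbours⊆ y∈N = proj₁ (∈-neighbours⁻ y∈N)

    neighbours-∅ : ∀ R → ∣ neighbours R ∅ ∣ ≡ 0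
    neighbours-∅ R = trans (cong ∣_∣ (Empty-unique λ (y , y∈N) → ∉⊥ (proj₁ (proj₂ (proj₂ (∈-neighbours⁻ y∈N)))))) (∣⊥∣≡0 n)

    neighbours-─ : ∀ {R S} Q → neighbours R S ⊆ neighbours (R ─ Q) S ∪ Q
    neighbours-─ {R} {S} Q {y} y∈N with ∈-neighbours⁻ y∈N | y ∈? Q
    ... | _              | yes y∈Q = x∈p∪q⁺ (inj₂ y∈Q)
    ... | y∈R , x , x∈S , xy | no y∉Q = x∈p∪q⁺ (inj₁ (∈-neighbours⁺ (x∈p∧x∉q⇒x∈p─q y∈R y∉Q) x∈S xy))

    neighbours-∪ : ∀ {R} S T → neighbours R (S ∪ T) ⊆ neighbours (R ─ neighbours R T) S ∪ neighbours R T
    neighbours-∪ {R} S T {y} y∈N with ∈-neighbours⁻ y∈N | y ∈? neighbours R T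
    ... | _ | yes y∈NT = x∈p∪q⁺ (inj₂ y∈NT)
    ... | y∈R , x , x∈S∪T , xy | no y∉NT with x∈p∪q⁻ S T x∈S∪T
    ...   | inj₁ x∈S = x∈p∪q⁺ (inj₁ (∈-neighbours⁺ (x∈p∧x∉q⇒x∈p─q y∈R y∉NT) x∈S xy))
    ...   | inj₂ x∈T = ⊥-elim (y∉NT (∈-neighbours⁺ y∈R x∈T xy))

    EdgeBetween : Subset n → Subset n → Fin n × Fin n → Set
    EdgeBetween L R (x , y) = x ∈ L × y ∈ R × adj G x y ≡ true

    MatchingBetween : Subset n → Subset n → List (Fin n × Fin n) → Set
    MatchingBetween L R M = All (EdgeBetween L R) M × Unique (endpoints M)

    matchingBetween⇒isMatching : ∀ {L R M} → MatchingBetween L R M → IsMatching G M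
    matchingBetween⇒isMatching (edges , unique) = All.map (λ (_ , _ , xy) → xy) edges , unique

    edgeBetween-mono : ∀ {L₁ L₂ R₁ R₂} → L₁ ⊆ L₂ → R₁ ⊆ R₂ → ∀ {e} → EdgeBetween L₁ R₁ e → EdgeBetween L₂ R₂ e
    edgeBetween-mono L₁⊆L₂ R₁⊆R₂ (x∈L , y∈R , xy) = L₁⊆L₂ x∈L , R₁⊆R₂ y∈R , xy

    matchingBetween-mono : ∀ {L₁ L₂ R₁ R₂ M} → L₁ ⊆ L₂ → R₁ ⊆ R₂ → MatchingBetween L₁ R₁ M → MatchingBetween L₂ R₂ M
    matchingBetween-mono L₁⊆L₂ R₁⊆R₂ (edges , unique) = All.map (edgeBetween-mono L₁⊆L₂ R₁⊆R₂) edges , unique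

    matchingBetween-neighbours : ∀ {S R M} → MatchingBetween S R M → MatchingBetween S (neighbours R S) M
    matchingBetween-neighbours (edges , unique) = All.map (λ (x∈S , y∈R , xy) → x∈S , ∈-neighbours⁺ y∈R x∈S xy , xy) edges , unique

    matchingBetween-edge : ∀ {x y} → adj G x y ≡ true → MatchingBetween ⁅ x ⁆ ⁅ y ⁆ ((x , y) ∷ [])
    matchingBetween-edge {x} {y} xy = (x∈⁅x⁆ x , x∈⁅x⁆ y , xy) ∷ [] , (x≢y ∷ []) ∷ [] ∷ []
      where
      x≢y : x ≢ y
      x≢y refl with () ← trans (sym xy) (irrefl G x)

    endpoints∈ : ∀ {L R M} → All (EdgeBetween L R) M → All (λ v → v ∈ L ⊎ v ∈ R) (endpoints M)
    endpoints∈ []                        = []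
    endpoints∈ ((x∈L , y∈R , _) ∷ edges) = inj₁ x∈L ∷ inj₂ y∈R ∷ endpoints∈ edges

    matchingBetween-++ : ∀ {L R L₁ R₁ M₁ M₂} → Disjoint L R → L₁ ⊆ L → R₁ ⊆ R →
      MatchingBetween L₁ R₁ M₁ → MatchingBetween (L ─ L₁) (R ─ R₁) M₂ → MatchingBetween L R (M₁ ++ M₂)
    matchingBetween-++ {L} {R} {L₁} {R₁} {M₁} {M₂} L∩R≡∅ L₁⊆L R₁⊆R (edges₁ , unique₁) (edges₂ , unique₂) =
      All.++⁺ (All.map (edgeBetween-mono L₁⊆L R₁⊆R) edges₁) (All.map (edgeBetween-mono (p─q⊆p L L₁) (p─q⊆p R R₁)) edges₂) ,
      subst Unique (sym (concatMap-++ _ M₁ M₂)) (Unique.++⁺ unique₁ unique₂ apart)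
      where
      apart : ∀ {v} → ¬ (v ∈ₗ endpoints M₁ × v ∈ₗ endpoints M₂)
      apart (v∈M₁ , v∈M₂) with All.lookup (endpoints∈ edges₁) v∈M₁ | All.lookup (endpoints∈ edges₂) v∈M₂
      ... | inj₁ v∈L₁ | inj₁ v∈L─L₁ = x∈p─q⇒x∉q v∈L─L₁ v∈L₁
      ... | inj₁ v∈L₁ | inj₂ v∈R─R₁ = L∩R≡∅ _ (L₁⊆L v∈L₁) (p─q⊆p R R₁ v∈R─R₁)
      ... | inj₂ v∈R₁ | inj₁ v∈L─L₁ = L∩R≡∅ _ (p─q⊆p L L₁ v∈L─L₁) (R₁⊆R v∈R₁)
      ... | inj₂ v∈R₁ | inj₂ v∈R─R₁ = x∈p─q⇒x∉q v∈R─R₁ v∈R₁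

    HallCondition : ℕ → Subset n → Subset n → Set
    HallCondition k L R = ∀ S → S ⊆ L → ∣ S ∣ ≤ ∣ neighbours R S ∣ + k

    SaturatesAllBut : ℕ → Subset n → Subset n → Set
    SaturatesAllBut k L R = ∃ λ M → MatchingBetween L R M × ∣ L ∣ ≤ length M + k

    HallBelow : ℕ → Set
    HallBelow m = ∀ {L R k} → ∣ L ∣ < m → Disjoint L R → HallCondition k L R → SaturatesAllBut k L R

    isolated-surplus : ∀ {L R k x} → x ∈ L → Empty (neighbours R ⁅ x ⁆) → HallCondition k L R →
      ∀ S → S ⊆ L - x → suc ∣ S ∣ ≤ ∣ neighbours R S ∣ + k
    isolated-surplus {L} {R} {k} {x} x∈L isolated H S S⊆L-x = begin
      suc ∣ S ∣                                        ≡⟨ ℕ.+-comm 1 ∣ S ∣ ⟩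
      ∣ S ∣ + 1                                        ≡⟨ cong (∣ S ∣ +_) (∣⁅x⁆∣≡1 x) ⟨
      ∣ S ∣ + ∣ ⁅ x ⁆ ∣                               ≡⟨ ∣p∪q∣≡∣p∣+∣q∣ S ⁅ x ⁆ S∩⁅x⁆≡∅ ⟨
      ∣ S ∪ ⁅ x ⁆ ∣                                   ≤⟨ H (S ∪ ⁅ x ⁆) (∪-lub (p─q⊆p L ⁅ x ⁆ ∘ S⊆L-x) (x∈p⇒⁅x⁆⊆p x∈L)) ⟩
      ∣ neighbours R (S ∪ ⁅ x ⁆) ∣ + k                ≤⟨ ℕ.+-monoˡ-≤ k (p⊆q⇒∣p∣≤∣q∣ (neighbours-∪ S ⁅ x ⁆)) ⟩
      ∣ neighbours (R ─ Nx) S ∪ Nx ∣ + k               ≤⟨ ℕ.+-monoˡ-≤ k (∣p∪q∣≤∣p∣+∣q∣ (neighbours (R ─ Nx) S) Nx) ⟩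
      ∣ neighbours (R ─ Nx) S ∣ + ∣ Nx ∣ + k           ≡⟨ cong (λ N → ∣ neighbours (R ─ N) S ∣ + ∣ N ∣ + k) (Empty-unique isolated) ⟩
      ∣ neighbours (R ─ ∅) S ∣ + ∣ ∅ {n} ∣ + k         ≡⟨ cong₂ (λ R′ z → ∣ neighbours R′ S ∣ + z + k) (p─⊥≡p R) (∣⊥∣≡0 n) ⟩
      ∣ neighbours R S ∣ + 0 + k                       ≡⟨ cong (_+ k) (ℕ.+-identityʳ _) ⟩
      ∣ neighbours R S ∣ + k                           ∎
      where
      open ℕ.≤-Reasoning
      Nx : Subset n
      Nx = neighbours R ⁅ x ⁆
      S∩⁅x⁆≡∅ : Disjoint S ⁅ x ⁆
      S∩⁅x⁆≡∅ v v∈S v∈⁅x⁆ = x∈p─q⇒x∉q (S⊆L-x v∈S) v∈⁅x⁆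

    saturate-isolated : ∀ {L R k x} → x ∈ L → Empty (neighbours R ⁅ x ⁆) →
      Disjoint L R → HallCondition k L R → HallBelow ∣ L ∣ → SaturatesAllBut k L R
    saturate-isolated {R = R} {zero} x∈L isolated _ H _ =
      ⊥-elim (ℕ.1+n≰n (subst₂ (λ a b → suc a ≤ b + 0) (∣⊥∣≡0 n) (neighbours-∅ R) (isolated-surplus x∈L isolated H ∅ (⊆-min _))))
    saturate-isolated {L} {R} {suc k} {x} x∈L isolated L∩R≡∅ H ih
      with ih (x∈p⇒∣p-x∣<∣p∣ x∈L) (disjoint-⊆ L∩R≡∅ (p─q⊆p L ⁅ x ⁆) id) H′
      where
      H′ : HallCondition k (L - x) R
      H′ S S⊆L-x = ℕ.≤-pred (ℕ.≤-trans (isolated-surplus x∈L isolated H S S⊆L-x) (ℕ.≤-reflexive (ℕ.+-suc _ k)))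
    ... | M , matching , bound =
      M , matchingBetween-mono (p─q⊆p L ⁅ x ⁆) id matching , (begin
        ∣ L ∣               ≡⟨ x∈p⇒∣p∣≡∣p-x∣+1 x∈L ⟩
        ∣ L - x ∣ + 1       ≤⟨ ℕ.+-monoˡ-≤ 1 bound ⟩
        length M + k + 1    ≡⟨ ℕ.+-assoc (length M) k 1 ⟩
        length M + (k + 1)  ≡⟨ cong (length M +_) (ℕ.+-comm k 1) ⟩
        length M + suc k    ∎)
      where
      open ℕ.≤-Reasoning

    Tight : ℕ → Subset n → Subset n → Subset n → Set
    Tight k L R S = S ⊆ L × 0 < ∣ S ∣ × ∣ S ∣ < ∣ L ∣ × ∣ neighbours R S ∣ + k ≤ ∣ S ∣

    tight? : ∀ k L R S → Dec (Tight k L R S)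
    tight? k L R S = S ⊆? L ×-dec 0 <? ∣ S ∣ ×-dec ∣ S ∣ <? ∣ L ∣ ×-dec ∣ neighbours R S ∣ + k ≤? ∣ S ∣

    saturate-edge : ∀ {L R k x y} → x ∈ L → y ∈ neighbours R ⁅ x ⁆ → ¬ ∃ (Tight k L R) →
      Disjoint L R → HallCondition k L R → HallBelow ∣ L ∣ → SaturatesAllBut k L R
    saturate-edge {L} {R} {k} {x} {y} x∈L y∈Nx no-tight L∩R≡∅ H ih
      with ih (x∈p⇒∣p-x∣<∣p∣ x∈L) (disjoint-⊆ L∩R≡∅ (p─q⊆p L ⁅ x ⁆) (p─q⊆p R ⁅ y ⁆)) H′
      where
      H′ : HallCondition k (L - x) (R - y)
      H′ S S⊆L-x with ∣ S ∣ in ∣S∣≡1+s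
      ... | zero  = z≤n
      ... | suc s = ℕ.≤-pred (begin
        suc (suc s)                                    ≡⟨ cong suc ∣S∣≡1+s ⟨
        suc ∣ S ∣                                      ≤⟨ ℕ.≰⇒> (λ deficient → no-tight (S , S⊆L , 0<∣S∣ , ∣S∣<∣L∣ , deficient)) ⟩
        ∣ neighbours R S ∣ + k                         ≤⟨ ℕ.+-monoˡ-≤ k (p⊆q⇒∣p∣≤∣q∣ (neighbours-─ ⁅ y ⁆)) ⟩
        ∣ neighbours (R - y) S ∪ ⁅ y ⁆ ∣ + k           ≤⟨ ℕ.+-monoˡ-≤ k (∣p∪q∣≤∣p∣+∣q∣ (neighbours (R - y) S) ⁅ y ⁆) ⟩
        ∣ neighbours (R - y) S ∣ + ∣ ⁅ y ⁆ ∣ + k       ≡⟨ cong (λ z → ∣ neighbours (R - y) S ∣ + z + k) (∣⁅x⁆∣≡1 y) ⟩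
        ∣ neighbours (R - y) S ∣ + 1 + k               ≡⟨ ℕ.+-assoc (∣ neighbours (R - y) S ∣) 1 k ⟩
        ∣ neighbours (R - y) S ∣ + suc k               ≡⟨ ℕ.+-suc (∣ neighbours (R - y) S ∣) k ⟩
        suc (∣ neighbours (R - y) S ∣ + k)             ∎)
        where
        open ℕ.≤-Reasoning
        S⊆L : S ⊆ L
        S⊆L = p─q⊆p L ⁅ x ⁆ ∘ S⊆L-x
        0<∣S∣ : 0 < ∣ S ∣
        0<∣S∣ = subst (0 <_) (sym ∣S∣≡1+s) ℕ.z<s
        ∣S∣<∣L∣ : ∣ S ∣ < ∣ L ∣
        ∣S∣<∣L∣ = ℕ.≤-<-trans (p⊆q⇒∣p∣≤∣q∣ S⊆L-x) (x∈p⇒∣p-x∣<∣p∣ x∈L)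
    ... | M , matching , bound =
      (x , y) ∷ M ,
      matchingBetween-++ L∩R≡∅ (x∈p⇒⁅x⁆⊆p x∈L) (x∈p⇒⁅x⁆⊆p y∈R) (matchingBetween-edge xy) matching ,
      (begin
        ∣ L ∣               ≡⟨ x∈p⇒∣p∣≡∣p-x∣+1 x∈L ⟩
        ∣ L - x ∣ + 1       ≤⟨ ℕ.+-monoˡ-≤ 1 bound ⟩
        length M + k + 1    ≡⟨ ℕ.+-comm (length M + k) 1 ⟩
        suc (length M) + k  ∎)
      where
      open ℕ.≤-Reasoning
      y∈R : y ∈ R
      y∈R = proj₁ (∈-neighbours⁻ y∈Nx)
      xy : adj G x y ≡ true
      xy with _ , _ , x′∈⁅x⁆ , x′y ← ∈-neighbours⁻ y∈Nx = subst (λ z → adj G z y ≡ true) (x∈⁅y⁆⇒x≡y x x′∈⁅x⁆) x′y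

    saturate-tight : ∀ {L R k S} → Tight k L R S →
      Disjoint L R → HallCondition k L R → HallBelow ∣ L ∣ → SaturatesAllBut k L R
    saturate-tight {L} {R} {k} {S} (S⊆L , 0<∣S∣ , ∣S∣<∣L∣ , deficient) L∩R≡∅ H ih
      with ih ∣S∣<∣L∣ (disjoint-⊆ L∩R≡∅ S⊆L id) (λ T T⊆S → H T (S⊆L ∘ T⊆S))
         | ih ∣L─S∣<∣L∣ (disjoint-⊆ L∩R≡∅ (p─q⊆p L S) (p─q⊆p R N)) H′
      where
      N : Subset n
      N = neighbours R S
      ∣L─S∣<∣L∣ : ∣ L ─ S ∣ < ∣ L ∣
      ∣L─S∣<∣L∣ = subst (∣ L ─ S ∣ <_) (sym (∣p∣≡∣p─q∣+∣q∣ L S S⊆L)) (ℕ.m<m+n (∣ L ─ S ∣) 0<∣S∣)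
      H′ : HallCondition 0 (L ─ S) (R ─ N)
      H′ T T⊆L─S = ℕ.≤-trans (ℕ.+-cancelʳ-≤ (∣ S ∣) (∣ T ∣) (∣ neighbours (R ─ N) T ∣) (begin
        ∣ T ∣ + ∣ S ∣                                           ≡⟨ ∣p∪q∣≡∣p∣+∣q∣ T S T∩S≡∅ ⟨
        ∣ T ∪ S ∣                                              ≤⟨ H (T ∪ S) (∪-lub (p─q⊆p L S ∘ T⊆L─S) S⊆L) ⟩
        ∣ neighbours R (T ∪ S) ∣ + k                           ≤⟨ ℕ.+-monoˡ-≤ k (p⊆q⇒∣p∣≤∣q∣ (neighbours-∪ T S)) ⟩
        ∣ neighbours (R ─ N) T ∪ N ∣ + k                        ≤⟨ ℕ.+-monoˡ-≤ k (∣p∪q∣≤∣p∣+∣q∣ (neighbours (R ─ N) T) N) ⟩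
        ∣ neighbours (R ─ N) T ∣ + ∣ N ∣ + k                    ≡⟨ ℕ.+-assoc (∣ neighbours (R ─ N) T ∣) (∣ N ∣) k ⟩
        ∣ neighbours (R ─ N) T ∣ + (∣ N ∣ + k)                  ≤⟨ ℕ.+-monoʳ-≤ (∣ neighbours (R ─ N) T ∣) deficient ⟩
        ∣ neighbours (R ─ N) T ∣ + ∣ S ∣                        ∎))
        (ℕ.m≤m+n (∣ neighbours (R ─ N) T ∣) 0)
        where
        open ℕ.≤-Reasoning
        T∩S≡∅ : Disjoint T S
        T∩S≡∅ v v∈T v∈S = x∈p─q⇒x∉q (T⊆L─S v∈T) v∈S
    ... | M₁ , matching₁ , bound₁ | M₂ , matching₂ , bound₂ =
      M₁ ++ M₂ ,
      matchingBetween-++ L∩R≡∅ S⊆L neighbours⊆ (matchingBetween-neighbours matching₁) matching₂ ,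
      (begin
        ∣ L ∣                              ≡⟨ ∣p∣≡∣p─q∣+∣q∣ L S S⊆L ⟩
        ∣ L ─ S ∣ + ∣ S ∣                  ≤⟨ ℕ.+-mono-≤ bound₂ bound₁ ⟩
        length M₂ + 0 + (length M₁ + k)    ≡⟨ regroup (length M₁) (length M₂) k ⟩
        length M₁ + length M₂ + k          ≡⟨ cong (_+ k) (length-++ M₁) ⟨
        length (M₁ ++ M₂) + k              ∎)
      where
      open ℕ.≤-Reasoning
      regroup : ∀ a b k → b + 0 + (a + k) ≡ a + b + k
      regroup = solve-∀

    hall-step : ∀ {L R k} → HallBelow ∣ L ∣ → Disjoint L R → HallCondition k L R → SaturatesAllBut k L R
    hall-step {L} {R} {k} ih L∩R≡∅ H with nonempty? L
    ... | no L≡∅ = [] , ([] , []) , subst (_≤ k) (sym (trans (cong ∣_∣ (Empty-unique L≡∅)) (∣⊥∣≡0 n))) z≤n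
    ... | yes (x , x∈L) with anySubset? (tight? k L R)
    ...   | yes (_ , tight) = saturate-tight tight L∩R≡∅ H ih
    ...   | no no-tight with nonempty? (neighbours R ⁅ x ⁆)
    ...     | yes (_ , y∈Nx) = saturate-edge x∈L y∈Nx no-tight L∩R≡∅ H ih
    ...     | no isolated    = saturate-isolated x∈L isolated L∩R≡∅ H ih

    hall-below : ∀ m → HallBelow m
    hall-below (suc m) ∣L∣<1+m = hall-step λ ∣L′∣<∣L∣ → hall-below m (ℕ.<-≤-trans ∣L′∣<∣L∣ (ℕ.≤-pred ∣L∣<1+m))

    hall : ∀ {L R k} → Disjoint L R → HallCondition k L R → SaturatesAllBut k L R
    hall {L} = hall-below (suc ∣ L ∣) (ℕ.n<1+n ∣ L ∣)

    konig-ore : ∀ U W → Disjoint U W →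
      ∃₂ λ M S → MatchingBetween U W M × S ⊆ U × ∣ U ∣ + ∣ neighbours W S ∣ ≤ length M + ∣ S ∣
    konig-ore U W U∩W≡∅ = search ∣ U ∣ (λ S S⊆U → ℕ.≤-trans (p⊆q⇒∣p∣≤∣q∣ S⊆U) (ℕ.m≤n+m ∣ U ∣ _))
      where
      -- k decreases while Hall's condition with deficiency k − 1 holds; a set violating it is the witness.
      search : ∀ k → HallCondition k U W →
        ∃₂ λ M S → MatchingBetween U W M × S ⊆ U × ∣ U ∣ + ∣ neighbours W S ∣ ≤ length M + ∣ S ∣
      search zero H₀ with hall U∩W≡∅ H₀
      ... | M , matching , bound = M , ∅ , matching , ⊆-min _ ,
        subst₂ (λ a b → ∣ U ∣ + a ≤ length M + b) (sym (neighbours-∅ W)) (sym (∣⊥∣≡0 n))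
          (ℕ.≤-trans (ℕ.≤-reflexive (ℕ.+-identityʳ ∣ U ∣)) bound)
      search (suc k) H₁₊ₖ with anySubset? (λ S → S ⊆? U ×-dec suc (∣ neighbours W S ∣ + k) ≤? ∣ S ∣)
      ... | no none = search k λ S S⊆U → ℕ.≤-pred (ℕ.≰⇒> λ deficient → none (S , S⊆U , deficient))
      ... | yes (S , S⊆U , deficient) with hall U∩W≡∅ H₁₊ₖ
      ...   | M , matching , bound = M , S , matching , S⊆U , (begin
        ∣ U ∣ + ∣ neighbours W S ∣                   ≤⟨ ℕ.+-monoˡ-≤ ∣ neighbours W S ∣ bound ⟩
        length M + suc k + ∣ neighbours W S ∣        ≡⟨ regroup (length M) k ∣ neighbours W S ∣ ⟩
        length M + suc (∣ neighbours W S ∣ + k)      ≤⟨ ℕ.+-monoʳ-≤ (length M) deficient ⟩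
        length M + ∣ S ∣                             ∎)
        where
        open ℕ.≤-Reasoning
        regroup : ∀ a k b → a + suc k + b ≡ a + suc (b + k)
        regroup = solve-∀

    closedNeighbourhood : Subset n → Subset n → Subset n
    closedNeighbourhood R S = S ∪ neighbours R S

  module Bipartite {n} (G : Graph n) (U W : Subset n) (bipartite : IsBipartition G U W) where

    U∩W≡∅ : Disjoint U W
    U∩W≡∅ v v∈U v∈W with proj₁ bipartite v
    ... | inj₁ (_ , v∉W) = v∉W v∈W
    ... | inj₂ (v∉U , _) = v∉U v∈U

    ∣U∣+∣W∣≡n : ∣ U ∣ + ∣ W ∣ ≡ n
    ∣U∣+∣W∣≡n = trans (sym (∣p∪q∣≡∣p∣+∣q∣ U W U∩W≡∅))
      (ℕ.≤-antisym (∣p∣≤n (U ∪ W)) (subst (_≤ ∣ U ∪ W ∣) (∣⊤∣≡n n) (p⊆q⇒∣p∣≤∣q∣ ⊤⊆U∪W)))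
      where
      ⊤⊆U∪W : ⊤ ⊆ U ∪ W
      ⊤⊆U∪W {v} _ with proj₁ bipartite v
      ... | inj₁ (v∈U , _) = x∈p∪q⁺ (inj₁ v∈U)
      ... | inj₂ (_ , v∈W) = x∈p∪q⁺ (inj₂ v∈W)

    module _ {S} (S⊆U : S ⊆ U) where

      closedNeighbourhood-size : ∣ S ∣ + ∣ neighbours G W S ∣ + ∣ ∁ (closedNeighbourhood G W S) ∣ ≡ n
      closedNeighbourhood-size = trans (cong (_+ ∣ ∁ (closedNeighbourhood G W S) ∣) (sym (∣p∪q∣≡∣p∣+∣q∣ S (neighbours G W S) S∩N≡∅)))
        (∣p∣+∣∁p∣≡n (closedNeighbourhood G W S))
        where
        S∩N≡∅ : Disjoint S (neighbours G W S)
        S∩N≡∅ = disjoint-⊆ U∩W≡∅ S⊆U (neighbours⊆ G)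

      ∁closedNeighbourhood-disjoint : Disjoint S (∁ (closedNeighbourhood G W S))
      ∁closedNeighbourhood-disjoint v v∈S v∈Y = x∈∁p⇒x∉p v∈Y (x∈p∪q⁺ (inj₁ v∈S))

      ∁closedNeighbourhood-noEdge : NoEdgeBetween G S (∁ (closedNeighbourhood G W S))
      ∁closedNeighbourhood-noEdge x y x∈S y∈Y with adj G x y in xy
      ... | Bool.false = refl
      ... | true with proj₂ bipartite x y xy
      ...   | inj₁ (_ , y∈W) = ⊥-elim (x∈∁p⇒x∉p y∈Y (x∈p∪q⁺ (inj₂ (∈-neighbours⁺ G y∈W x∈S xy))))
      ...   | inj₂ (x∈W , _) = ⊥-elim (U∩W≡∅ x (S⊆U x∈S) x∈W)

      ∣∁closedNeighbourhood∣<n : 0 < ∣ S ∣ → ∣ ∁ (closedNeighbourhood G W S) ∣ < n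
      ∣∁closedNeighbourhood∣<n 0<∣S∣ = subst (∣ ∁ (closedNeighbourhood G W S) ∣ <_) closedNeighbourhood-size
        (ℕ.m<n+m _ (ℕ.<-≤-trans 0<∣S∣ (ℕ.m≤m+n ∣ S ∣ _)))

open import Data.Nat using (ℕ; suc)
open import Data.Fin.Subset using (Subset; ∣_∣)
open import Data.Rational using (ℚ; 0ℚ; 1ℚ; _<_; _≤_; _*_; _-_; _⊓_)
import Data.Nat as ℕ
import Data.Nat.Properties as ℕ
open import Data.Fin.Subset using (∁)
open import Data.Fin.Subset.Properties using (p⊆q⇒∣p∣≤∣q∣)
open import Data.List using (length)
open import Data.Product using (_,_)
open import Relation.Nullary using (yes; no)
open Arithmetic
open Matching
open Matching.Bipartite using (U∩W≡∅)

theorem3p5 : (β t : ℚ) → 0ℚ < β → 1ℚ ≤ t →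
    ∀ (m : ℕ) (G : Graph (suc m)) (U W : Subset (suc m)) →
    IsBipartition G U W →
    t * ℕ→ℚ ∣ U ∣ ≤ ℕ→ℚ ∣ W ∣ →
    WeaklyGraph G β →
    MatchingNumber≥ G (((t * (1ℚ - ℕ→ℚ 2 * (β * β))) ⊓ 1ℚ) * ℕ→ℚ ∣ U ∣)
theorem3p5 β t _ 1≤t m G U W bipartite tU≤W weak with konig-ore G U W (U∩W≡∅ G U W bipartite)
... | M , S , matching , S⊆U , deficiency = M , matchingBetween⇒isMatching G matching , size-bound
  where
  open Bipartite G U W bipartite
  size-bound : ((t * (1ℚ - ℕ→ℚ 2 * (β * β))) ⊓ 1ℚ) * ℕ→ℚ ∣ U ∣ ≤ ℕ→ℚ (length M)
  size-bound with ∣ U ∣ ℕ.≤? length M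
  ... | yes ∣U∣≤∣M∣ = ⊓1-bound (t * (1ℚ - ℕ→ℚ 2 * (β * β))) ∣U∣≤∣M∣
  ... | no ∣U∣≰∣M∣ =
    deficient-set-bound (β * β) t 1≤t ∣U∣+∣W∣≡n (closedNeighbourhood-size S⊆U) tU≤W ∣S∣≤∣U∣ ∣M∣<∣U∣ deficiency
      (weak S (∁ (closedNeighbourhood G W S))
        (∣p∣<n⇒p≢⊤ ∣S∣<n) (∣p∣<n⇒p≢⊤ (∣∁closedNeighbourhood∣<n S⊆U 0<∣S∣))
        (∁closedNeighbourhood-disjoint S⊆U) (∁closedNeighbourhood-noEdge S⊆U))
    where
    ∣S∣≤∣U∣ : ∣ S ∣ ℕ.≤ ∣ U ∣
    ∣S∣≤∣U∣ = p⊆q⇒∣p∣≤∣q∣ S⊆U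
    ∣M∣<∣U∣ : length M ℕ.< ∣ U ∣
    ∣M∣<∣U∣ = ℕ.≰⇒> ∣U∣≰∣M∣
    0<∣S∣ : 0 ℕ.< ∣ S ∣
    0<∣S∣ = ν<u≤ν+d⇒0<d ∣M∣<∣U∣ (ℕ.≤-trans (ℕ.m≤m+n ∣ U ∣ _) deficiency)
    ∣S∣<n : ∣ S ∣ ℕ.< suc m
    ∣S∣<n = deficient-set-proper 1≤t tU≤W ∣U∣+∣W∣≡n ∣M∣<∣U∣ ∣S∣≤∣U∣
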